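{- Let $X$ be a locale, $\mathcal{L}$ a language, $P$ a sheaf of $\mathcal{L}$-structures on $X$, $(\mathcal{M},\delta):=\Theta(P)$, and $\mathfrak f$ a filter on $\mathcal{O}(X)$. Then the canonical map $P/\mathfrak f\to\mathcal{M}/{\sim_{\mathfrak f}}$, sending the class of $(U,a)$ (with $U\in\mathfrak f$, $a\in P(U)$) to $[a]_{\mathfrak f}$, is well defined and induces a bijection between $P/\mathfrak f$ and the set of global elements of $\mathcal{M}/{\sim_{\mathfrak f}}$, i.e. the set $\{[a]_{\mathfrak f}: a\in\mathcal{M},\ \delta(a)\in\mathfrak f\}$.
   Context: A locale $X$ is given by its frame $\mathcal{O}(X)$ (complete Heyting algebra, implication $\to$, top $1_X$). A sheaf on $X$ is a functor $P:\mathcal{O}(X)^{op}\to\mathbf{Set}$ (restriction written $a\mapsto a|_W$) such that for any $U=\bigvee_iU_i$ and compatible family $a_i\in P(U_i)$ ($a_i|_{U_i\wedge U_j}=a_j|_{U_i\wedge U_j}$) there is a unique $a\in P(U)$ with $a|_{U_i}=a_i$. A sheaf of $\mathcal{L}$-structures is an $\mathcal{L}$-structure in $\mathbf{Sh}(X)$: a sheaf $P$ with morphisms $f^P:P^n\to P$ for function symbols and subsheaves $R^P\subseteq P^n$ for relation symbols. $\Theta(P)$ is the $\mathcal{O}(X)$-valued set with underlying set $\mathcal{M}=\coprod_{U\in\mathcal{O}(X)}P(U)$ and, for $a\in P(U)$, $b\in P(V)$, $\delta(a,b)=\bigvee\{W\le U\wedge V: a|_W=b|_W\}$; so $\delta(a):=\delta(a,a)=U$.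 For a filter $\mathfrak f$, $P/\mathfrak f:=\varinjlim_{U\in\mathfrak f}P(U)$ is the quotient of $\coprod_{U\in\mathfrak f}P(U)$ by $(U,a)\sim(V,b)$ iff there is $W\in\mathfrak f$ with $W\le U\wedge V$ and $a|_W=b|_W$. On $\mathcal{M}$, $a\sim_{\mathfrak f}b$ iff $(\delta(a)\vee\delta(b)\to\delta(a,b))\in\mathfrak f$, an equivalence relation with classes $[a]_{\mathfrak f}$; the valuation on the quotient is $\delta_{\mathfrak f}([a]_{\mathfrak f},[b]_{\mathfrak f})=[\delta(a,b)]_{\mathfrak f}$ in the quotient Heyting algebra $\mathcal{O}(X)/\mathfrak f$, and a global element is a class with $\delta_{\mathfrak f}([a]_{\mathfrak f})=[1_X]_{\mathfrak f}$, equivalently $\delta(a)\in\mathfrak f$. -}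

module Defs where

open import Data.Nat using (ℕ)
open import Data.Fin using (Fin)
open import Data.Bool using (Bool; true; false; if_then_else_)
open import Data.Product using (Σ; _×_; _,_; proj₁; proj₂)
open import Relation.Binary.PropositionalEquality using (_≡_)

-- Frames (= the frame O(X) of a locale X), carrier and joins at level 0.
-- Complete lattice with finite meets distributing over joins; we include
-- the Heyting implication as data with its adjunction law (which implies
-- the infinite distributive law).

record Frame : Set₁ where
  infix 4 _≤_
  infixr 6 _∧_
  infixr 5 _⇒_
  field
    Carrier   : Set
    _≤_       : Carrier → Carrier → Set
    ≤-irrelevant : ∀ {a b} (p q : a ≤ b) → p ≡ q
    ≤-refl    : ∀ {a} → a ≤ a
    ≤-trans   : ∀ {a b c} → a ≤ b → b ≤ c → a ≤ c
    ≤-antisym : ∀ {a b} → a ≤ b → b ≤ a → a ≡ b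
    ⋁         : (I : Set) → (I → Carrier) → Carrier
    ⋁-ub      : ∀ (I : Set) (u : I → Carrier) (i : I) → u i ≤ ⋁ I u
    ⋁-least   : ∀ (I : Set) (u : I → Carrier) (c : Carrier) →
                (∀ i → u i ≤ c) → ⋁ I u ≤ c
    ⊤         : Carrier
    ≤-⊤       : ∀ {a} → a ≤ ⊤
    _∧_       : Carrier → Carrier → Carrier
    ∧-lb₁     : ∀ {a b} → a ∧ b ≤ a
    ∧-lb₂     : ∀ {a b} → a ∧ b ≤ b
    ∧-glb     : ∀ {a b c} → c ≤ a → c ≤ b → c ≤ a ∧ b
    _⇒_       : Carrier → Carrier → Carrier
    ⇒-intro   : ∀ {a b c} → c ∧ a ≤ b → c ≤ a ⇒ b
    ⇒-elim    : ∀ {a b c} → c ≤ a ⇒ b → c ∧ a ≤ b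

  _∨_ : Carrier → Carrier → Carrier
  a ∨ b = ⋁ Bool (λ i → if i then a else b)

record Filter (O : Frame) : Set₁ where
  open Frame O
  field
    member   : Carrier → Set
    up-closed : ∀ {a b} → a ≤ b → member a → member b
    has-⊤    : member ⊤
    ∧-closed : ∀ {a b} → member a → member b → member (a ∧ b)

-- Sheaves on a frame.  A presheaf is a functor O^op → Set; since ≤ is
-- proof-irrelevant the functor laws are stated for any proofs.

record Sheaf (O : Frame) : Set₁ where
  open Frame O
  field
    Sec      : Carrier → Set
    restrict : ∀ {U V} → V ≤ U → Sec U → Sec V
    restrict-id   : ∀ {U} (p : U ≤ U) (a : Sec U) → restrict p a ≡ a
    restrict-comp : ∀ {U V W} (p : V ≤ U) (q : W ≤ V) (r : W ≤ U) (a : Sec U) →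
                    restrict q (restrict p a) ≡ restrict r a
    glue : ∀ (I : Set) (u : I → Carrier) (s : ∀ i → Sec (u i)) →
           (∀ i j → restrict (∧-lb₁ {u i} {u j}) (s i)
                  ≡ restrict (∧-lb₂ {u i} {u j}) (s j)) →
           Σ (Sec (⋁ I u)) λ a →
             (∀ i → restrict (⋁-ub I u i) a ≡ s i) ×
             (∀ b → (∀ i → restrict (⋁-ub I u i) b ≡ s i) → b ≡ a)

record Language : Set₁ where
  field
    FunSym   : Set
    funArity : FunSym → ℕ
    RelSym   : Set
    relArity : RelSym → ℕ

record SheafStructure (O : Frame) (L : Language) : Set₁ where
  open Frame O
  open Language L
  field
    sheaf : Sheaf O
  open Sheaf sheaf
  field
    fun     : ∀ (f : FunSym) {U} → (Fin (funArity f) → Sec U) → Sec U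
    fun-nat : ∀ (f : FunSym) {U V} (p : V ≤ U) (as : Fin (funArity f) → Sec U) →
              restrict p (fun f as) ≡ fun f (λ k → restrict p (as k))
    -- interpretations of relation symbols: subsheaves R ⊆ P^n
    rel       : ∀ (r : RelSym) {U} → (Fin (relArity r) → Sec U) → Set
    rel-restr : ∀ (r : RelSym) {U V} (p : V ≤ U) (as : Fin (relArity r) → Sec U) →
                rel r as → rel r (λ k → restrict p (as k))
    rel-local : ∀ (r : RelSym) (I : Set) (u : I → Carrier)
                (as : Fin (relArity r) → Sec (⋁ I u)) →
                (∀ i → rel r (λ k → restrict (⋁-ub I u i) (as k))) → rel r as

module Constructions {O : Frame} (P : Sheaf O) (𝔣 : Filter O) where
  open Frame O
  open Sheaf P
  open Filter 𝔣

  -- underlying set of Θ(P): ∐_{U} P(U)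
  M : Set
  M = Σ Carrier Sec

  δ₂ : M → M → Carrier
  δ₂ (U , a) (V , b) =
    ⋁ (Σ Carrier λ W → Σ (W ≤ U ∧ V) λ p →
          restrict (≤-trans p ∧-lb₁) a ≡ restrict (≤-trans p ∧-lb₂) b)
      proj₁

  δ : M → Carrier
  δ a = δ₂ a a

  _∼𝔣_ : M → M → Set
  a ∼𝔣 b = member ((δ a ∨ δ b) ⇒ δ₂ a b)

  IsGlobal : M → Set
  IsGlobal a = member (δ a)

  -- ∐_{U ∈ 𝔣} P(U), with the relation presenting P/𝔣 = colim_{U∈𝔣} P(U)
  P𝔣 : Set
  P𝔣 = Σ Carrier λ U → member U × Sec U

  _≈P𝔣_ : P𝔣 → P𝔣 → Set
  (U , _ , a) ≈P𝔣 (V , _ , b) =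
    Σ Carrier λ W → member W × Σ (W ≤ U ∧ V) λ p →
      restrict (≤-trans p ∧-lb₁) a ≡ restrict (≤-trans p ∧-lb₂) b

  canon : P𝔣 → M
  canon (U , _ , a) = (U , a)

-- A section a ∈ P(U) is the global element [a] because δ(a) = U, and any
-- global class [a] comes from the section a itself, which lives over
-- δ(a) ∈ 𝔣.  Injectivity is the one place where the sheaf condition enters:
-- two sections agree on every piece of the join δ(a,b), hence by locality on
-- δ(a,b) itself, and δ(a,b) ∈ 𝔣 by modus ponens in the filter, since
-- δ(a) ∨ δ(b) ≥ U ∈ 𝔣 and (δ(a) ∨ δ(b) ⇒ δ(a,b)) ∈ 𝔣.
module Submission where

open import Defs
open import Data.Product using (Σ; _×_; _,_; proj₁; proj₂)
open import Data.Bool using (Bool; true; false)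
open import Relation.Binary.PropositionalEquality using (_≡_; refl; sym; trans; cong)

module FrameProperties (O : Frame) where
  open Frame O

  ∨-upperˡ : ∀ {a b} → a ≤ a ∨ b
  ∨-upperˡ = ⋁-ub Bool _ true

  ∨-least : ∀ {a b c} → a ≤ c → b ≤ c → a ∨ b ≤ c
  ∨-least a≤c b≤c = ⋁-least Bool _ _ λ { true → a≤c ; false → b≤c }

  ⇒-weaken : ∀ {a b c} → c ≤ b → c ≤ a ⇒ b
  ⇒-weaken c≤b = ⇒-intro (≤-trans ∧-lb₁ c≤b)

  ⊤≤⇒ : ∀ {a b} → a ≤ b → ⊤ ≤ a ⇒ b
  ⊤≤⇒ a≤b = ⇒-intro (≤-trans ∧-lb₂ a≤b)

  modus-ponens : ∀ {a b} → a ∧ (a ⇒ b) ≤ b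
  modus-ponens = ≤-trans (∧-glb ∧-lb₂ ∧-lb₁) (⇒-elim ≤-refl)

module FilterProperties {O : Frame} (𝔣 : Filter O) where
  open Frame O
  open Filter 𝔣
  open FrameProperties O

  member-⇒ : ∀ {a b} → a ≤ b → member (a ⇒ b)
  member-⇒ a≤b = up-closed (⊤≤⇒ a≤b) has-⊤

  member-mp : ∀ {a b} → member a → member (a ⇒ b) → member b
  member-mp ma ma⇒b = up-closed modus-ponens (∧-closed ma ma⇒b)

module SheafProperties {O : Frame} (P : Sheaf O) where
  open Frame O
  open Sheaf P

  restrict-irrelevant : ∀ {U V} (p q : V ≤ U) (a : Sec U) → restrict p a ≡ restrict q a
  restrict-irrelevant p q a = cong (λ r → restrict r a) (≤-irrelevant p q)

  locality : ∀ (I : Set) (u : I → Carrier) (a b : Sec (⋁ I u)) →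
             (∀ i → restrict (⋁-ub I u i) a ≡ restrict (⋁-ub I u i) b) → a ≡ b
  locality I u a b agree = trans (unique a λ _ → refl) (sym (unique b (λ i → sym (agree i))))
    where
    s : ∀ i → Sec (u i)
    s i = restrict (⋁-ub I u i) a
    compatible : ∀ i j → restrict (∧-lb₁ {u i} {u j}) (s i) ≡ restrict (∧-lb₂ {u i} {u j}) (s j)
    compatible i j = trans (restrict-comp _ _ (≤-trans ∧-lb₁ (⋁-ub I u i)) a)
                           (sym (restrict-comp _ _ _ a))
    unique : ∀ c → (∀ i → restrict (⋁-ub I u i) c ≡ s i) → c ≡ proj₁ (glue I u s compatible)
    unique = proj₂ (proj₂ (glue I u s compatible))

module CanonicalMap {O : Frame} (P : Sheaf O) (𝔣 : Filter O) where
  open Frame O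
  open Sheaf P
  open Filter 𝔣
  open Constructions P 𝔣
  open FrameProperties O
  open FilterProperties 𝔣
  open SheafProperties P

  δ₂-≤-∧ : ∀ {U V} (a : Sec U) (b : Sec V) → δ₂ (U , a) (V , b) ≤ U ∧ V
  δ₂-≤-∧ a b = ⋁-least _ _ _ λ i → proj₁ (proj₂ i)

  δ-≤ : ∀ {U} (a : Sec U) → δ (U , a) ≤ U
  δ-≤ a = ≤-trans (δ₂-≤-∧ a a) ∧-lb₁

  ≤-δ : ∀ {U} (a : Sec U) → U ≤ δ (U , a)
  ≤-δ {U} a = ⋁-ub _ proj₁ (U , ∧-glb ≤-refl ≤-refl , restrict-irrelevant _ _ a)

  agree-on-δ₂ : ∀ {U V} (a : Sec U) (b : Sec V) →
                restrict (≤-trans (δ₂-≤-∧ a b) ∧-lb₁) a ≡ restrict (≤-trans (δ₂-≤-∧ a b) ∧-lb₂) b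
  agree-on-δ₂ a b = locality _ proj₁ _ _ λ { (W , p , a|W≡b|W) →
    trans (restrict-comp _ _ _ a) (trans a|W≡b|W (sym (restrict-comp _ _ _ b))) }

  ∼𝔣-refl : ∀ m → m ∼𝔣 m
  ∼𝔣-refl m = member-⇒ (∨-least ≤-refl ≤-refl)

  canon-respects : ∀ x y → x ≈P𝔣 y → canon x ∼𝔣 canon y
  canon-respects _ _ (W , W∈𝔣 , p , a|W≡b|W) =
    up-closed (⇒-weaken (⋁-ub _ proj₁ (W , p , a|W≡b|W))) W∈𝔣

  canon-global : ∀ x → IsGlobal (canon x)
  canon-global (_ , U∈𝔣 , a) = up-closed (≤-δ a) U∈𝔣

  canon-reflects : ∀ x y → canon x ∼𝔣 canon y → x ≈P𝔣 y
  canon-reflects (_ , U∈𝔣 , a) (_ , _ , b) a∼b =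
    δ₂ (_ , a) (_ , b) ,
    member-mp (up-closed (≤-trans (≤-δ a) ∨-upperˡ) U∈𝔣) a∼b ,
    δ₂-≤-∧ a b ,
    agree-on-δ₂ a b

  canon-onto-global : ∀ m → IsGlobal m → Σ P𝔣 λ x → canon x ∼𝔣 m
  canon-onto-global m@(_ , a) δa∈𝔣 = (_ , up-closed (δ-≤ a) δa∈𝔣 , a) , ∼𝔣-refl m

mainTheorem5 : (O : Frame) (L : Language) (S : SheafStructure O L) (𝔣 : Filter O) →
    let open Constructions (SheafStructure.sheaf S) 𝔣 in
    -- well defined
    (∀ x y → x ≈P𝔣 y → canon x ∼𝔣 canon y) ×
    -- lands in the global elements
    (∀ x → IsGlobal (canon x)) ×
    -- injective on classes
    (∀ x y → canon x ∼𝔣 canon y → x ≈P𝔣 y) ×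
    -- surjective onto the global elements
    (∀ m → IsGlobal m → Σ P𝔣 λ x → canon x ∼𝔣 m)
mainTheorem5 O L S 𝔣 = canon-respects , canon-global , canon-reflects , canon-onto-global
  where open CanonicalMap (SheafStructure.sheaf S) 𝔣
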